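{- Let $p$ be an odd prime, $d\ge1$ an integer, $G\cong\mathbb{Z}_p^d$, and $A_2=\{a\in\{1,\dots,p-1\}: a\not\equiv x^2\pmod p \text{ for all } x\in\{1,\dots,p\}\}$ (the quadratic non-residues). Then $d_{A_2}(G)=2d+1$.
   Context: For a finite abelian group $G$ (written additively) of exponent $n$ and a non-empty subset $A\subseteq\{1,\dots,n\}$, $d_A(G)$ denotes the least positive integer $t$ such that every sequence $(g_1,\dots,g_t)$ of $t$ (not necessarily distinct) elements of $G$ has a non-empty subsequence $g_{i_1},\dots,g_{i_\ell}$ (distinct indices) and elements $a_1,\dots,a_\ell\in A$ (not necessarily distinct) with $\sum_{j=1}^{\ell}a_j g_{i_j}=0$ in $G$. $\mathbb{Z}_p^d$ is the direct sum of $d$ copies of $\mathbb{Z}/p\mathbb{Z}$. -}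

module Defs where

open import Data.Nat using (ℕ; zero; suc; _+_; _*_; _∸_; _≤_; _%_; NonZero)
open import Data.Fin using (Fin; toℕ)
import Data.Fin as F
open import Data.Bool using (Bool; true; false)
open import Data.Product using (_×_; ∃)
open import Relation.Binary.PropositionalEquality using (_≡_; _≢_)

Σ[_] : (t : ℕ) → (Fin t → ℕ) → ℕ
Σ[ zero ] f = 0
Σ[ suc t ] f = f F.zero + Σ[ t ] (λ i → f (F.suc i))

ZpD : ℕ → ℕ → Set
ZpD p d = Fin d → Fin p

sel : Bool → ℕ → ℕ
sel true  a = a
sel false _ = 0

HasAZeroSum : (A : ℕ → Set) (p d t : ℕ) .{{_ : NonZero p}} → (Fin t → ZpD p d) → Set
HasAZeroSum A p d t g =
  ∃ λ (S : Fin t → Bool) → ∃ λ (a : Fin t → ℕ) →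
    (∃ λ i → S i ≡ true) ×
    (∀ i → S i ≡ true → A (a i)) ×
    (∀ (k : Fin d) → Σ[ t ] (λ i → sel (S i) (a i) * toℕ (g i k)) % p ≡ 0)

AllHaveAZeroSum : (A : ℕ → Set) (p d t : ℕ) .{{_ : NonZero p}} → Set
AllHaveAZeroSum A p d t = ∀ (g : Fin t → ZpD p d) → HasAZeroSum A p d t g

DavenportA≡ : (A : ℕ → Set) (p d m : ℕ) .{{_ : NonZero p}} → Set
DavenportA≡ A p d m =
  (1 ≤ m) × AllHaveAZeroSum A p d m × (∀ t → 1 ≤ t → AllHaveAZeroSum A p d t → m ≤ t)

A₂ : (p : ℕ) .{{_ : NonZero p}} → ℕ → Set
A₂ p a = (1 ≤ a) × (a ≤ p ∸ 1) × (∀ x → 1 ≤ x → x ≤ p → a % p ≢ (x * x) % p)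

-- Upper bound: for g₁, …, g_N ∈ ℤ_p^d with N = 2d + 1, the d diagonal quadratic forms
-- Q_k(x) = Σᵢ (gᵢ)_k xᵢ² in N variables have total degree 2d < N, so by the Chevalley–Warning
-- theorem they have a common nontrivial zero x. For a fixed quadratic non-residue n the weights
-- n xᵢ² (xᵢ ≢ 0) are non-residues, and Σᵢ n xᵢ² gᵢ = 0.
-- Lower bound: e₁, −n e₁, …, e_d, −n e_d has no weighted zero-sum. In a coordinate containing
-- a chosen term it would give a single nonzero term, or a ≡ b n with a, b non-residues; but a
-- product of two non-residues is a residue.
-- Chevalley–Warning: Σ_x Πₖ (1 − Q_k(x)^(p−1)) ≡ 0 (mod p), because every monomial of degree
-- < N(p − 1) has an exponent e < p − 1 and Σ_y y^e ≡ 0 for such e. The summand is 1 at the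
-- common zeros and 0 elsewhere, and the origin is a common zero, so there is another one.

module Submission where

open import Defs
open import Data.Nat using (ℕ; _≤_; _+_; _*_; _<_)
open import Data.Nat.Primality using (Prime; prime⇒nonZero)

open import Algebra.Bundles using (CommutativeSemiring)
import Algebra.Definitions.RawMonoid as RawMonoid
import Algebra.Definitions.RawSemiring as RawSemiring
import Algebra.Properties.CommutativeSemigroup as CommutativeSemigroupProperties
import Algebra.Properties.CommutativeSemiring.Binomial as Binomial
open import Data.Bool using (Bool; true; false)
open import Data.Empty using (⊥; ⊥-elim)
open import Data.Fin as F using (Fin; toℕ; fromℕ; fromℕ<; inject₁; _↑ˡ_; _↑ʳ_)
import Data.Fin.Properties as FP
import Data.Vec.Functional as Vec
open import Data.List using (List; []; _∷_; _++_; map; tabulate)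
open import Data.List.Relation.Unary.All using (All; []; _∷_)
open import Data.Nat
  using (zero; suc; _∸_; _/_; _^_; _%_; _!; pred; z≤n; z<s; s≤s; s≤s⁻¹; _≟_; _<?_; _≤?_;
         NonZero; >-nonZero; >-nonZero⁻¹; nonTrivial⇒n>1)
open import Data.Nat.Combinatorics using (_C_; nCn≡1; nC1≡n; nCk≡nC[n∸k]; nCk≡n!/k![n-k]!; k![n∸k]!∣n!)
open import Data.Nat.DivMod
open import Data.Nat.Divisibility
open import Data.Nat.Primality using (euclidsLemma; prime⇒irreducible; prime⇒nonTrivial)
open import Data.Nat.Induction using (<-rec)
open import Data.Nat.Properties
open import Data.Nat.Tactic.RingSolver using (solve-∀)
open import Data.Product using (_×_; _,_; ∃; ∃₂; proj₁; proj₂; uncurry)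
open import Data.Sum using (_⊎_; inj₁; inj₂; [_,_]′) renaming (map to ⊎-map)
open import Function using (_∘_)
open import Relation.Binary using (IsEquivalence; Setoid)
import Relation.Binary.Reasoning.Setoid as SetoidReasoning
open import Relation.Binary.PropositionalEquality
open import Relation.Nullary using (¬_; Dec; yes; no; contradiction)
open import Relation.Nullary.Decidable using (map′)

open CommutativeSemigroupProperties +-commutativeSemigroup using () renaming (interchange to +-interchange)
open CommutativeSemigroupProperties *-commutativeSemigroup using () renaming (interchange to *-interchange)

-- Sums and products over Fin

Σ-cong : ∀ t {f g : Fin t → ℕ} → (∀ i → f i ≡ g i) → Σ[ t ] f ≡ Σ[ t ] g
Σ-cong zero    f≗g = refl
Σ-cong (suc t) f≗g = cong₂ _+_ (f≗g F.zero) (Σ-cong t (f≗g ∘ F.suc))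

Σ-zero : ∀ t (f : Fin t → ℕ) → (∀ i → f i ≡ 0) → Σ[ t ] f ≡ 0
Σ-zero zero    f f≗0 = refl
Σ-zero (suc t) f f≗0 = cong₂ _+_ (f≗0 F.zero) (Σ-zero t (f ∘ F.suc) (f≗0 ∘ F.suc))

Σ-const : ∀ t c → Σ[ t ] (λ _ → c) ≡ t * c
Σ-const zero    c = refl
Σ-const (suc t) c = cong (c +_) (Σ-const t c)

Σ-distrib-+ : ∀ t (f g : Fin t → ℕ) → Σ[ t ] (λ i → f i + g i) ≡ Σ[ t ] f + Σ[ t ] g
Σ-distrib-+ zero    f g = refl
Σ-distrib-+ (suc t) f g =
  trans (cong (f F.zero + g F.zero +_) (Σ-distrib-+ t (f ∘ F.suc) (g ∘ F.suc)))
        (+-interchange (f F.zero) (g F.zero) _ _)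

Σ-distribˡ-* : ∀ t c (f : Fin t → ℕ) → Σ[ t ] (λ i → c * f i) ≡ c * Σ[ t ] f
Σ-distribˡ-* zero    c f = sym (*-zeroʳ c)
Σ-distribˡ-* (suc t) c f =
  trans (cong (c * f F.zero +_) (Σ-distribˡ-* t c (f ∘ F.suc))) (sym (*-distribˡ-+ c _ _))

Σ-distribʳ-* : ∀ t c (f : Fin t → ℕ) → Σ[ t ] (λ i → f i * c) ≡ Σ[ t ] f * c
Σ-distribʳ-* t c f = trans (Σ-cong t (λ i → *-comm (f i) c)) (trans (Σ-distribˡ-* t c f) (*-comm c _))

Σ-comm : ∀ t s (f : Fin t → Fin s → ℕ) →
         Σ[ t ] (λ i → Σ[ s ] (f i)) ≡ Σ[ s ] (λ j → Σ[ t ] (λ i → f i j))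
Σ-comm zero    s f = sym (Σ-zero s _ (λ _ → refl))
Σ-comm (suc t) s f =
  trans (cong (Σ[ s ] (f F.zero) +_) (Σ-comm t s (f ∘ F.suc))) (sym (Σ-distrib-+ s (f F.zero) _))

Σ-init-last : ∀ t (f : Fin (suc t) → ℕ) → Σ[ suc t ] f ≡ Σ[ t ] (f ∘ inject₁) + f (fromℕ t)
Σ-init-last zero    f = +-comm (f F.zero) 0
Σ-init-last (suc t) f =
  trans (cong (f F.zero +_) (Σ-init-last t (f ∘ F.suc))) (sym (+-assoc (f F.zero) _ _))

Σ-shift : ∀ t (h : ℕ → ℕ) → h 0 + Σ[ t ] (λ i → h (suc (toℕ i))) ≡ Σ[ t ] (λ i → h (toℕ i)) + h t
Σ-shift t h = trans (Σ-init-last t (h ∘ toℕ))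
  (cong₂ _+_ (Σ-cong t (λ i → cong h (FP.toℕ-inject₁ i))) (cong h (FP.toℕ-fromℕ t)))

Σ-++ : ∀ t u (f : Fin (t + u) → ℕ) → Σ[ t + u ] f ≡ Σ[ t ] (f ∘ (_↑ˡ u)) + Σ[ u ] (f ∘ (t ↑ʳ_))
Σ-++ zero    u f = refl
Σ-++ (suc t) u f = trans (cong (f F.zero +_) (Σ-++ t u (f ∘ F.suc))) (sym (+-assoc (f F.zero) _ _))

Σ-mono-≤ : ∀ t {f g : Fin t → ℕ} → (∀ i → f i ≤ g i) → Σ[ t ] f ≤ Σ[ t ] g
Σ-mono-≤ zero    f≤g = z≤n
Σ-mono-≤ (suc t) f≤g = +-mono-≤ (f≤g F.zero) (Σ-mono-≤ t (f≤g ∘ F.suc))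

Σ-single : ∀ t (f : Fin t → ℕ) u → (∀ i → i ≢ u → f i ≡ 0) → Σ[ t ] f ≡ f u
Σ-single (suc t) f F.zero    f≡0 =
  trans (cong (f F.zero +_) (Σ-zero t _ (λ i → f≡0 (F.suc i) λ ()))) (+-identityʳ _)
Σ-single (suc t) f (F.suc u) f≡0 =
  cong₂ _+_ (f≡0 F.zero λ ())
    (Σ-single t (f ∘ F.suc) u (λ i i≢u → f≡0 (F.suc i) (i≢u ∘ FP.suc-injective)))

Σ-pair : ∀ t (f : Fin t → ℕ) u v → u ≢ v → (∀ i → i ≢ u → i ≢ v → f i ≡ 0) →
         Σ[ t ] f ≡ f u + f v
Σ-pair (suc t) f F.zero    F.zero    u≢v f≡0 = contradiction refl u≢v
Σ-pair (suc t) f F.zero    (F.suc v) u≢v f≡0 =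
  cong (f F.zero +_) (Σ-single t (f ∘ F.suc) v (λ i i≢v → f≡0 (F.suc i) (λ ()) (i≢v ∘ FP.suc-injective)))
Σ-pair (suc t) f (F.suc u) F.zero    u≢v f≡0 =
  trans (cong (f F.zero +_)
           (Σ-single t (f ∘ F.suc) u (λ i i≢u → f≡0 (F.suc i) (i≢u ∘ FP.suc-injective) (λ ()))))
        (+-comm (f F.zero) _)
Σ-pair (suc t) f (F.suc u) (F.suc v) u≢v f≡0 =
  cong₂ _+_ (f≡0 F.zero (λ ()) (λ ()))
    (Σ-pair t (f ∘ F.suc) u v (u≢v ∘ cong F.suc)
      (λ i i≢u i≢v → f≡0 (F.suc i) (i≢u ∘ FP.suc-injective) (i≢v ∘ FP.suc-injective)))

Σ<*⇒∃< : ∀ t c (f : Fin t → ℕ) → Σ[ t ] f < t * c → ∃ λ i → f i < c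
Σ<*⇒∃< t c f Σf<tc with FP.any? (λ i → f i <? c)
... | yes fi<c = fi<c
... | no  ∄fi<c = contradiction (Σ-mono-≤ t (λ i → ≮⇒≥ (λ fi<c → ∄fi<c (i , fi<c))))
                                (<⇒≱ (subst (Σ[ t ] f <_) (sym (Σ-const t c)) Σf<tc))

Σ-positive : ∀ t (f : Fin t → ℕ) → 0 < Σ[ t ] f → ∃ λ i → 0 < f i
Σ-positive (suc t) f Σf>0 with f F.zero ≟ 0
... | no  f0≢0 = F.zero , n≢0⇒n>0 f0≢0
... | yes f0≡0 with Σ-positive t (f ∘ F.suc) (subst (λ c → 0 < c + Σ[ t ] (f ∘ F.suc)) f0≡0 Σf>0)
...   | i , fi>0 = F.suc i , fi>0

∣-Σ : ∀ {d} t (f : Fin t → ℕ) → (∀ i → d ∣ f i) → d ∣ Σ[ t ] f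
∣-Σ {d} zero f _ = d ∣0
∣-Σ (suc t) f d∣f = ∣m∣n⇒∣m+n (d∣f F.zero) (∣-Σ t (f ∘ F.suc) (d∣f ∘ F.suc))

Π[_] : (t : ℕ) → (Fin t → ℕ) → ℕ
Π[ zero  ] f = 1
Π[ suc t ] f = f F.zero * Π[ t ] (f ∘ F.suc)

Π-cong : ∀ t {f g : Fin t → ℕ} → (∀ i → f i ≡ g i) → Π[ t ] f ≡ Π[ t ] g
Π-cong zero    f≗g = refl
Π-cong (suc t) f≗g = cong₂ _*_ (f≗g F.zero) (Π-cong t (f≗g ∘ F.suc))

Π-one : ∀ t (f : Fin t → ℕ) → (∀ i → f i ≡ 1) → Π[ t ] f ≡ 1
Π-one zero    f f≗1 = refl
Π-one (suc t) f f≗1 = cong₂ _*_ (f≗1 F.zero) (Π-one t (f ∘ F.suc) (f≗1 ∘ F.suc))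

Π-distrib-* : ∀ t (f g : Fin t → ℕ) → Π[ t ] (λ i → f i * g i) ≡ Π[ t ] f * Π[ t ] g
Π-distrib-* zero    f g = refl
Π-distrib-* (suc t) f g =
  trans (cong (f F.zero * g F.zero *_) (Π-distrib-* t (f ∘ F.suc) (g ∘ F.suc)))
        (*-interchange (f F.zero) (g F.zero) _ _)

Π-single : ∀ t (f : Fin t → ℕ) u → (∀ i → i ≢ u → f i ≡ 1) → Π[ t ] f ≡ f u
Π-single (suc t) f F.zero    f≡1 =
  trans (cong (f F.zero *_) (Π-one t _ (λ i → f≡1 (F.suc i) λ ()))) (*-identityʳ _)
Π-single (suc t) f (F.suc u) f≡1 =
  trans (cong₂ _*_ (f≡1 F.zero λ ())
                   (Π-single t (f ∘ F.suc) u (λ i i≢u → f≡1 (F.suc i) (i≢u ∘ FP.suc-injective))))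
        (*-identityˡ _)

∣-Π : ∀ {d} t (f : Fin t → ℕ) i → d ∣ f i → d ∣ Π[ t ] f
∣-Π (suc t) f F.zero    d∣fi = ∣m⇒∣m*n _ d∣fi
∣-Π (suc t) f (F.suc i) d∣fi = ∣n⇒∣m*n (f F.zero) (∣-Π t (f ∘ F.suc) i d∣fi)

splitAt-injective : ∀ m {n} {i j : Fin (m + n)} → F.splitAt m i ≡ F.splitAt m j → i ≡ j
splitAt-injective m {n} {i} {j} same =
  trans (sym (FP.join-splitAt m n i)) (trans (cong (F.join m n) same) (FP.join-splitAt m n j))

combine-remQuot-2 : ∀ d (i : Fin (2 * d)) →
  i ≡ F.combine {2} F.zero (proj₂ (F.remQuot {2} d i)) ⊎
  i ≡ F.combine {2} (F.suc F.zero) (proj₂ (F.remQuot {2} d i))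
combine-remQuot-2 d i = cases (F.remQuot {2} d i) (FP.combine-remQuot {2} d i)
  where
  cases : ∀ jk → uncurry F.combine jk ≡ i →
          i ≡ F.combine {2} F.zero (proj₂ jk) ⊎ i ≡ F.combine {2} (F.suc F.zero) (proj₂ jk)
  cases (F.zero       , k) combine≡i = inj₁ (sym combine≡i)
  cases (F.suc F.zero , k) combine≡i = inj₂ (sym combine≡i)

pigeonhole-ℕ : ∀ m (f : Fin (suc m) → ℕ) → (∀ i → 0 < f i × f i ≤ m) →
               ∃₂ λ i j → i F.< j × f i ≡ f j
pigeonhole-ℕ m f f∈[1,m] = collision (FP.pigeonhole (n<1+n m) index)
  where
  suc-pred-f : ∀ i → suc (pred (f i)) ≡ f i
  suc-pred-f i = suc-pred (f i) {{>-nonZero (proj₁ (f∈[1,m] i))}}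
  index : Fin (suc m) → Fin m
  index i = fromℕ< (subst (_≤ m) (sym (suc-pred-f i)) (proj₂ (f∈[1,m] i)))
  suc-index : ∀ i → suc (toℕ (index i)) ≡ f i
  suc-index i = trans (cong suc (FP.toℕ-fromℕ< _)) (suc-pred-f i)
  collision : (∃₂ λ i j → i F.< j × index i ≡ index j) → ∃₂ λ i j → i F.< j × f i ≡ f j
  collision (i , j , i<j , same) =
    i , j , i<j , trans (sym (suc-index i)) (trans (cong (suc ∘ toℕ) same) (suc-index j))

binomial : ∀ n x y → (x + y) ^ n ≡ Σ[ suc n ] (λ k → (n C toℕ k) * (x ^ toℕ k * y ^ (n ∸ toℕ k)))
binomial n x y = begin
  (x + y) ^ n                                ≡⟨ pow≡^ n (x + y) ⟨
  RawSemiring._^_ rawSemiring (x + y) n      ≡⟨ Binomial.theorem +-*-commutativeSemiring n x y ⟩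
  RawMonoid.sum +-rawMonoid binomialTerm     ≡⟨ sum≡Σ (suc n) binomialTerm ⟩
  Σ[ suc n ] binomialTerm                    ≡⟨ Σ-cong (suc n) term≡ ⟩
  Σ[ suc n ] (λ k → (n C toℕ k) * (x ^ toℕ k * y ^ (n ∸ toℕ k))) ∎
  where
  open ≡-Reasoning
  open CommutativeSemiring +-*-commutativeSemiring using (rawSemiring; +-rawMonoid)
  binomialTerm = Binomial.binomialTerm +-*-commutativeSemiring x y n

  pow≡^ : ∀ k z → RawSemiring._^_ rawSemiring z k ≡ z ^ k
  pow≡^ zero    z = refl
  pow≡^ (suc k) z = cong (z *_) (pow≡^ k z)

  ×≡* : ∀ k z → RawMonoid._×_ +-rawMonoid k z ≡ k * z
  ×≡* zero    z = refl
  ×≡* (suc k) z = cong (z +_) (×≡* k z)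

  sum≡Σ : ∀ t (f : Fin t → ℕ) → RawMonoid.sum +-rawMonoid f ≡ Σ[ t ] f
  sum≡Σ zero    f = refl
  sum≡Σ (suc t) f = cong (f F.zero +_) (sum≡Σ t (f ∘ F.suc))

  term≡ : ∀ k → binomialTerm k ≡ (n C toℕ k) * (x ^ toℕ k * y ^ (n ∸ toℕ k))
  term≡ k = trans (×≡* (n C toℕ k) _)
                  (cong ((n C toℕ k) *_) (cong₂ _*_ (pow≡^ (toℕ k) x) (pow≡^ (n ∸ toℕ k) y)))

-- Polynomials

onlyAt : ∀ {N} {A : Set} → A → Fin N → A → Fin N → A
onlyAt z i e j with i F.≟ j
... | yes _ = e
... | no  _ = z

onlyAt-here : ∀ {N} {A : Set} (z : A) (i : Fin N) e → onlyAt z i e i ≡ e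
onlyAt-here z i e with i F.≟ i
... | yes _   = refl
... | no  i≢i = contradiction refl i≢i

onlyAt-elsewhere : ∀ {N} {A : Set} (z : A) (i : Fin N) e j → j ≢ i → onlyAt z i e j ≡ z
onlyAt-elsewhere z i e j j≢i with i F.≟ j
... | yes i≡j = contradiction (sym i≡j) j≢i
... | no  _   = refl

data Monomial (N : ℕ) : Set where
  _·x^_ : ℕ → (Fin N → ℕ) → Monomial N

Polynomial : ℕ → Set
Polynomial N = List (Monomial N)

module _ {N : ℕ} where

  deg : Monomial N → ℕ
  deg (_ ·x^ e) = Σ[ N ] e

  Deg≤ : ℕ → Polynomial N → Set
  Deg≤ B P = All (λ m → deg m ≤ B) P

  ⟦_⟧ₘ : Monomial N → (Fin N → ℕ) → ℕ
  ⟦ c ·x^ e ⟧ₘ x = c * Π[ N ] (λ i → x i ^ e i)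

  ⟦_⟧ : Polynomial N → (Fin N → ℕ) → ℕ
  ⟦ []    ⟧ x = 0
  ⟦ m ∷ P ⟧ x = ⟦ m ⟧ₘ x + ⟦ P ⟧ x

  ⟦⟧-cong : ∀ P {x y : Fin N → ℕ} → (∀ i → x i ≡ y i) → ⟦ P ⟧ x ≡ ⟦ P ⟧ y
  ⟦⟧-cong []               x≗y = refl
  ⟦⟧-cong ((c ·x^ e) ∷ P) x≗y =
    cong₂ _+_ (cong (c *_) (Π-cong N (λ i → cong (_^ e i) (x≗y i)))) (⟦⟧-cong P x≗y)

  1ᵖ : Polynomial N
  1ᵖ = (1 ·x^ λ _ → 0) ∷ []

  ⟦1ᵖ⟧ : ∀ x → ⟦ 1ᵖ ⟧ x ≡ 1
  ⟦1ᵖ⟧ x = trans (+-identityʳ _) (trans (*-identityˡ _) (Π-one N _ (λ _ → refl)))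

  Deg≤-1ᵖ : ∀ B → Deg≤ B 1ᵖ
  Deg≤-1ᵖ B = subst (_≤ B) (sym (Σ-zero N _ (λ _ → refl))) z≤n ∷ []

  ⟦++⟧ : ∀ P Q x → ⟦ P ++ Q ⟧ x ≡ ⟦ P ⟧ x + ⟦ Q ⟧ x
  ⟦++⟧ []      Q x = refl
  ⟦++⟧ (m ∷ P) Q x = trans (cong (⟦ m ⟧ₘ x +_) (⟦++⟧ P Q x)) (sym (+-assoc (⟦ m ⟧ₘ x) _ _))

  Deg≤-++ : ∀ {B} {P Q : Polynomial N} → Deg≤ B P → Deg≤ B Q → Deg≤ B (P ++ Q)
  Deg≤-++ []            Q≤B = Q≤B
  Deg≤-++ (m≤B ∷ P≤B) Q≤B = m≤B ∷ Deg≤-++ P≤B Q≤B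

  _·ᵖ_ : ℕ → Polynomial N → Polynomial N
  c ·ᵖ P = map (λ { (c′ ·x^ e) → (c * c′) ·x^ e }) P

  ⟦·ᵖ⟧ : ∀ c P x → ⟦ c ·ᵖ P ⟧ x ≡ c * ⟦ P ⟧ x
  ⟦·ᵖ⟧ c []                x = sym (*-zeroʳ c)
  ⟦·ᵖ⟧ c ((c′ ·x^ e) ∷ P) x =
    trans (cong₂ _+_ (*-assoc c c′ _) (⟦·ᵖ⟧ c P x)) (sym (*-distribˡ-+ c _ _))

  Deg≤-·ᵖ : ∀ {B} c {P : Polynomial N} → Deg≤ B P → Deg≤ B (c ·ᵖ P)
  Deg≤-·ᵖ c                       []            = []
  Deg≤-·ᵖ c {(_ ·x^ _) ∷ _} (m≤B ∷ P≤B) = m≤B ∷ Deg≤-·ᵖ c P≤B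

  _*ₘ_ : Monomial N → Monomial N → Monomial N
  (c ·x^ e) *ₘ (c′ ·x^ e′) = (c * c′) ·x^ (λ i → e i + e′ i)

  ⟦*ₘ⟧ : ∀ m m′ x → ⟦ m *ₘ m′ ⟧ₘ x ≡ ⟦ m ⟧ₘ x * ⟦ m′ ⟧ₘ x
  ⟦*ₘ⟧ (c ·x^ e) (c′ ·x^ e′) x = trans
    (cong (c * c′ *_) (trans (Π-cong N (λ i → ^-distribˡ-+-* (x i) (e i) (e′ i))) (Π-distrib-* N _ _)))
    (*-interchange c c′ _ _)

  deg-*ₘ : ∀ m m′ → deg (m *ₘ m′) ≡ deg m + deg m′
  deg-*ₘ (c ·x^ e) (c′ ·x^ e′) = Σ-distrib-+ N e e′

  _*ᵖ_ : Polynomial N → Polynomial N → Polynomial N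
  []      *ᵖ Q = []
  (m ∷ P) *ᵖ Q = map (m *ₘ_) Q ++ (P *ᵖ Q)

  ⟦*ᵖ⟧ : ∀ P Q x → ⟦ P *ᵖ Q ⟧ x ≡ ⟦ P ⟧ x * ⟦ Q ⟧ x
  ⟦*ᵖ⟧ []      Q x = refl
  ⟦*ᵖ⟧ (m ∷ P) Q x = begin
    ⟦ map (m *ₘ_) Q ++ (P *ᵖ Q) ⟧ x             ≡⟨ ⟦++⟧ (map (m *ₘ_) Q) (P *ᵖ Q) x ⟩
    ⟦ map (m *ₘ_) Q ⟧ x + ⟦ P *ᵖ Q ⟧ x          ≡⟨ cong₂ _+_ (⟦map*ₘ⟧ Q) (⟦*ᵖ⟧ P Q x) ⟩
    ⟦ m ⟧ₘ x * ⟦ Q ⟧ x + ⟦ P ⟧ x * ⟦ Q ⟧ x      ≡⟨ *-distribʳ-+ (⟦ Q ⟧ x) (⟦ m ⟧ₘ x) _ ⟨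
    (⟦ m ⟧ₘ x + ⟦ P ⟧ x) * ⟦ Q ⟧ x              ∎
    where
    open ≡-Reasoning
    ⟦map*ₘ⟧ : ∀ Q → ⟦ map (m *ₘ_) Q ⟧ x ≡ ⟦ m ⟧ₘ x * ⟦ Q ⟧ x
    ⟦map*ₘ⟧ []       = sym (*-zeroʳ (⟦ m ⟧ₘ x))
    ⟦map*ₘ⟧ (m′ ∷ Q) =
      trans (cong₂ _+_ (⟦*ₘ⟧ m m′ x) (⟦map*ₘ⟧ Q)) (sym (*-distribˡ-+ (⟦ m ⟧ₘ x) _ _))

  Deg≤-*ᵖ : ∀ {B B′} {P Q : Polynomial N} → Deg≤ B P → Deg≤ B′ Q → Deg≤ (B + B′) (P *ᵖ Q)
  Deg≤-*ᵖ                 []            Q≤B′ = []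
  Deg≤-*ᵖ {P = m ∷ P} {Q} (m≤B ∷ P≤B) Q≤B′ = Deg≤-++ (deg-map*ₘ Q≤B′) (Deg≤-*ᵖ P≤B Q≤B′)
    where
    deg-map*ₘ : ∀ {Q} → Deg≤ _ Q → Deg≤ _ (map (m *ₘ_) Q)
    deg-map*ₘ []                  = []
    deg-map*ₘ {m′ ∷ Q} (m′≤B′ ∷ Q≤B′) =
      subst (_≤ _) (sym (deg-*ₘ m m′)) (+-mono-≤ m≤B m′≤B′) ∷ deg-map*ₘ Q≤B′

  _^ᵖ_ : Polynomial N → ℕ → Polynomial N
  P ^ᵖ zero  = 1ᵖ
  P ^ᵖ suc k = P *ᵖ (P ^ᵖ k)

  ⟦^ᵖ⟧ : ∀ P k x → ⟦ P ^ᵖ k ⟧ x ≡ ⟦ P ⟧ x ^ k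
  ⟦^ᵖ⟧ P zero    x = ⟦1ᵖ⟧ x
  ⟦^ᵖ⟧ P (suc k) x = trans (⟦*ᵖ⟧ P (P ^ᵖ k) x) (cong (⟦ P ⟧ x *_) (⟦^ᵖ⟧ P k x))

  Deg≤-^ᵖ : ∀ {B} {P : Polynomial N} k → Deg≤ B P → Deg≤ (k * B) (P ^ᵖ k)
  Deg≤-^ᵖ zero    P≤B = Deg≤-1ᵖ 0
  Deg≤-^ᵖ (suc k) P≤B = Deg≤-*ᵖ P≤B (Deg≤-^ᵖ k P≤B)

  Πᵖ[_] : ∀ d → (Fin d → Polynomial N) → Polynomial N
  Πᵖ[ zero  ] Ps = 1ᵖ
  Πᵖ[ suc d ] Ps = Ps F.zero *ᵖ Πᵖ[ d ] (Ps ∘ F.suc)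

  ⟦Πᵖ⟧ : ∀ d (Ps : Fin d → Polynomial N) x → ⟦ Πᵖ[ d ] Ps ⟧ x ≡ Π[ d ] (λ k → ⟦ Ps k ⟧ x)
  ⟦Πᵖ⟧ zero    Ps x = ⟦1ᵖ⟧ x
  ⟦Πᵖ⟧ (suc d) Ps x =
    trans (⟦*ᵖ⟧ (Ps F.zero) _ x) (cong (⟦ Ps F.zero ⟧ x *_) (⟦Πᵖ⟧ d (Ps ∘ F.suc) x))

  Deg≤-Πᵖ : ∀ d (Ps : Fin d → Polynomial N) B → (∀ k → Deg≤ (B k) (Ps k)) →
            Deg≤ (Σ[ d ] B) (Πᵖ[ d ] Ps)
  Deg≤-Πᵖ zero    Ps B Ps≤B = Deg≤-1ᵖ 0
  Deg≤-Πᵖ (suc d) Ps B Ps≤B =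
    Deg≤-*ᵖ (Ps≤B F.zero) (Deg≤-Πᵖ d (Ps ∘ F.suc) (B ∘ F.suc) (Ps≤B ∘ F.suc))

  diagonalForm : (Fin N → ℕ) → Polynomial N
  diagonalForm c = tabulate (λ i → c i ·x^ onlyAt 0 i 2)

  ⟦diagonalForm⟧ : ∀ c x → ⟦ diagonalForm c ⟧ x ≡ Σ[ N ] (λ i → c i * x i ^ 2)
  ⟦diagonalForm⟧ c x =
    trans (⟦tabulate⟧ N (λ i → c i ·x^ onlyAt 0 i 2)) (Σ-cong N (λ i → cong (c i *_) (Π-onlyAt i)))
    where
    ⟦tabulate⟧ : ∀ t (ms : Fin t → Monomial N) → ⟦ tabulate ms ⟧ x ≡ Σ[ t ] (λ i → ⟦ ms i ⟧ₘ x)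
    ⟦tabulate⟧ zero    ms = refl
    ⟦tabulate⟧ (suc t) ms = cong (⟦ ms F.zero ⟧ₘ x +_) (⟦tabulate⟧ t (ms ∘ F.suc))
    Π-onlyAt : ∀ i → Π[ N ] (λ j → x j ^ onlyAt 0 i 2 j) ≡ x i ^ 2
    Π-onlyAt i = trans (Π-single N _ i (λ j j≢i → cong (x j ^_) (onlyAt-elsewhere 0 i 2 j j≢i)))
                       (cong (x i ^_) (onlyAt-here 0 i 2))

  Deg≤-diagonalForm : ∀ c → Deg≤ 2 (diagonalForm c)
  Deg≤-diagonalForm c = Deg≤-tabulate N (λ i → c i ·x^ onlyAt 0 i 2) (λ i → ≤-reflexive (Σ-onlyAt i))
    where
    Σ-onlyAt : ∀ i → Σ[ N ] (onlyAt 0 i 2) ≡ 2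
    Σ-onlyAt i = trans (Σ-single N _ i (onlyAt-elsewhere 0 i 2)) (onlyAt-here 0 i 2)
    Deg≤-tabulate : ∀ t (ms : Fin t → Monomial N) → (∀ i → deg (ms i) ≤ 2) → Deg≤ 2 (tabulate ms)
    Deg≤-tabulate zero    ms ms≤2 = []
    Deg≤-tabulate (suc t) ms ms≤2 = ms≤2 F.zero ∷ Deg≤-tabulate t (ms ∘ F.suc) (ms≤2 ∘ F.suc)

-- Congruences

module Modulo (m : ℕ) .{{_ : NonZero m}} where

  infix 4 _≈_ _≈?_
  record _≈_ (a b : ℕ) : Set where
    constructor mk≈
    field %≡% : a % m ≡ b % m
  open _≈_ public

  ≈-isEquivalence : IsEquivalence _≈_
  ≈-isEquivalence = record
    { refl  = mk≈ refl
    ; sym   = λ (mk≈ e) → mk≈ (sym e)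
    ; trans = λ (mk≈ e) (mk≈ e′) → mk≈ (trans e e′)
    }

  ≈-setoid : Setoid _ _
  ≈-setoid = record { isEquivalence = ≈-isEquivalence }

  open IsEquivalence ≈-isEquivalence public
    using () renaming (refl to ≈-refl; sym to ≈-sym; trans to ≈-trans)

  module ≈-Reasoning = SetoidReasoning ≈-setoid

  ≡⇒≈ : ∀ {a b} → a ≡ b → a ≈ b
  ≡⇒≈ refl = ≈-refl

  %-≈ : ∀ a → a % m ≈ a
  %-≈ a = mk≈ (m%n%n≡m%n a m)

  +-cong : ∀ {a b c d} → a ≈ b → c ≈ d → a + c ≈ b + d
  +-cong {a} {b} {c} {d} (mk≈ a≈b) (mk≈ c≈d) = mk≈ (begin
    (a + c) % m              ≡⟨ %-distribˡ-+ a c m ⟩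
    (a % m + c % m) % m      ≡⟨ cong₂ (λ x y → (x + y) % m) a≈b c≈d ⟩
    (b % m + d % m) % m      ≡⟨ %-distribˡ-+ b d m ⟨
    (b + d) % m              ∎)
    where open ≡-Reasoning

  *-cong : ∀ {a b c d} → a ≈ b → c ≈ d → a * c ≈ b * d
  *-cong {a} {b} {c} {d} (mk≈ a≈b) (mk≈ c≈d) = mk≈ (begin
    (a * c) % m              ≡⟨ %-distribˡ-* a c m ⟩
    (a % m * (c % m)) % m    ≡⟨ cong₂ (λ x y → (x * y) % m) a≈b c≈d ⟩
    (b % m * (d % m)) % m    ≡⟨ %-distribˡ-* b d m ⟨
    (b * d) % m              ∎)
    where open ≡-Reasoning

  ^-cong : ∀ {a b} k → a ≈ b → a ^ k ≈ b ^ k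
  ^-cong zero    a≈b = ≈-refl
  ^-cong (suc k) a≈b = *-cong a≈b (^-cong k a≈b)

  Σ-cong-≈ : ∀ t {f g : Fin t → ℕ} → (∀ i → f i ≈ g i) → Σ[ t ] f ≈ Σ[ t ] g
  Σ-cong-≈ zero    f≈g = ≈-refl
  Σ-cong-≈ (suc t) f≈g = +-cong (f≈g F.zero) (Σ-cong-≈ t (f≈g ∘ F.suc))

  Π-cong-≈ : ∀ t {f g : Fin t → ℕ} → (∀ i → f i ≈ g i) → Π[ t ] f ≈ Π[ t ] g
  Π-cong-≈ zero    f≈g = ≈-refl
  Π-cong-≈ (suc t) f≈g = *-cong (f≈g F.zero) (Π-cong-≈ t (f≈g ∘ F.suc))

  *-cong-%ʳ : ∀ {c a b} → c * a ≈ c * b → c * (a % m) ≈ c * (b % m)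
  *-cong-%ʳ {c} {a} {b} ca≈cb =
    ≈-trans (*-cong (≈-refl {c}) (%-≈ a)) (≈-trans ca≈cb (*-cong (≈-refl {c}) (≈-sym (%-≈ b))))

  0%m≡0 : 0 % m ≡ 0
  0%m≡0 = m<n⇒m%n≡m (>-nonZero⁻¹ m)

  _≈?_ : ∀ a b → Dec (a ≈ b)
  a ≈? b = map′ mk≈ %≡% (a % m ≟ b % m)

  ∣⇒≈0 : ∀ {a} → m ∣ a → a ≈ 0
  ∣⇒≈0 {a} m∣a = mk≈ (trans (n∣m⇒m%n≡0 a m m∣a) (sym 0%m≡0))

  ≈0⇒∣ : ∀ {a} → a ≈ 0 → m ∣ a
  ≈0⇒∣ {a} (mk≈ a≈0) = m%n≡0⇒n∣m a m (trans a≈0 0%m≡0)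

  *m≈0 : ∀ k → k * m ≈ 0
  *m≈0 k = ∣⇒≈0 (n∣m*n k)

  +-cancelʳ-≈ : ∀ a b c → a + c ≈ b + c → a ≈ b
  +-cancelʳ-≈ a b c a+c≈b+c = begin
    a                        ≈⟨ +*m≈ a ⟨
    a + c * m                ≡⟨ regroup a ⟩
    a + c + c * pred m       ≈⟨ +-cong a+c≈b+c ≈-refl ⟩
    b + c + c * pred m       ≡⟨ regroup b ⟨
    b + c * m                ≈⟨ +*m≈ b ⟩
    b                        ∎
    where
    open ≈-Reasoning
    +*m≈ : ∀ x → x + c * m ≈ x
    +*m≈ x = ≈-trans (+-cong ≈-refl (*m≈0 c)) (≡⇒≈ (+-identityʳ x))
    regroup : ∀ x → x + c * m ≡ x + c + c * pred m
    regroup x = trans (cong (λ k → x + c * k) (sym (suc-pred m)))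
                      (trans (cong (x +_) (*-suc c (pred m))) (sym (+-assoc x c _)))

  ≈∧<⇒≡ : ∀ {a b} → a ≈ b → a < m → b < m → a ≡ b
  ≈∧<⇒≡ (mk≈ a%≡b%) a<m b<m = trans (sym (m<n⇒m%n≡m a<m)) (trans a%≡b% (m<n⇒m%n≡m b<m))

  [m∸y]²≈y² : ∀ {y} → y ≤ m → (m ∸ y) * (m ∸ y) ≈ y * y
  [m∸y]²≈y² {y} y≤m = +-cancelʳ-≈ _ _ ((m ∸ y) * y) (begin
    w * w + w * y     ≡⟨ *-distribˡ-+ w w y ⟨
    w * (w + y)       ≡⟨ cong (w *_) (m∸n+n≡m y≤m) ⟩
    w * m             ≈⟨ *m≈0 w ⟩
    0                 ≈⟨ *m≈0 y ⟨
    y * m             ≡⟨ cong (y *_) (m+[n∸m]≡n y≤m) ⟨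
    y * (y + w)       ≡⟨ *-distribˡ-+ y y w ⟩
    y * y + y * w     ≡⟨ cong (y * y +_) (*-comm y w) ⟩
    y * y + w * y     ∎)
    where
    open ≈-Reasoning
    w = m ∸ y

  ≤∧≈⇒∣∸ : ∀ {a b} → a ≤ b → a ≈ b → m ∣ b ∸ a
  ≤∧≈⇒∣∸ {a} {b} a≤b a≈b =
    ≈0⇒∣ (+-cancelʳ-≈ (b ∸ a) 0 a (≈-trans (≡⇒≈ (m∸n+n≡m a≤b)) (≈-sym a≈b)))

-- The prime is passed as suc q so that p ∸ 1 and 0 % p compute.
module PrimeModulus (q : ℕ) (pp : Prime (suc q)) where

  p : ℕ
  p = suc q

  open Modulo p public

  1<p : 1 < p
  1<p = nonTrivial⇒n>1 p {{prime⇒nonTrivial pp}}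

  1≉0 : ¬ 1 ≈ 0
  1≉0 (mk≈ 1%p≡0) = contradiction (trans (sym (m<n⇒m%n≡m 1<p)) 1%p≡0) λ ()

  ∣*∧∤⇒∣ʳ : ∀ {a b} → p ∣ a * b → p ∤ a → p ∣ b
  ∣*∧∤⇒∣ʳ {a} {b} p∣ab p∤a with euclidsLemma a b pp p∣ab
  ... | inj₁ p∣a = contradiction p∣a p∤a
  ... | inj₂ p∣b = p∣b

  ∣*∧∤⇒∣ˡ : ∀ {a b} → p ∣ a * b → p ∤ b → p ∣ a
  ∣*∧∤⇒∣ˡ {a} {b} p∣ab = ∣*∧∤⇒∣ʳ (subst (p ∣_) (*-comm a b) p∣ab)

  ∤-* : ∀ {a b} → p ∤ a → p ∤ b → p ∤ a * b
  ∤-* p∤a p∤b p∣ab = p∤b (∣*∧∤⇒∣ʳ p∣ab p∤a)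

  ∣∧<⇒≡0 : ∀ {a} → p ∣ a → a < p → a ≡ 0
  ∣∧<⇒≡0 {zero}  _   _   = refl
  ∣∧<⇒≡0 {suc a} p∣a a<p = contradiction (∣⇒≤ p∣a) (<⇒≱ a<p)

  ∤-pos : ∀ {a} → 0 < a → a < p → p ∤ a
  ∤-pos 0<a a<p p∣a = >⇒≢ 0<a (∣∧<⇒≡0 p∣a a<p)

  ∤⇒%>0 : ∀ {a} → p ∤ a → 0 < a % p
  ∤⇒%>0 {a} p∤a = n≢0⇒n>0 (p∤a ∘ m%n≡0⇒n∣m a p)

  *-cancelˡ-≈⇒≡ : ∀ {c a b} → p ∤ c → a ≤ b → b < p → c * a ≈ c * b → a ≡ b
  *-cancelˡ-≈⇒≡ {c} {a} {b} p∤c a≤b b<p ca≈cb = ≤-antisym a≤b (m∸n≡0⇒m≤n b∸a≡0)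
    where
    p∣c[b∸a] : p ∣ c * (b ∸ a)
    p∣c[b∸a] = subst (p ∣_) (sym (*-distribˡ-∸ c b a)) (≤∧≈⇒∣∸ (*-monoʳ-≤ c a≤b) ca≈cb)
    b∸a≡0 : b ∸ a ≡ 0
    b∸a≡0 = ∣∧<⇒≡0 (∣*∧∤⇒∣ʳ p∣c[b∸a] p∤c) (≤-<-trans (m∸n≤m b a) b<p)

  *-cancelˡ-≈ : ∀ {c a b} → p ∤ c → c * a ≈ c * b → a ≈ b
  *-cancelˡ-≈ {c} {a} {b} p∤c ca≈cb with ≤-total (a % p) (b % p)
  ... | inj₁ a%≤b% = mk≈ (*-cancelˡ-≈⇒≡ p∤c a%≤b% (m%n<n b p) (*-cong-%ʳ {c} ca≈cb))
  ... | inj₂ b%≤a% = mk≈ (sym (*-cancelˡ-≈⇒≡ p∤c b%≤a% (m%n<n a p) (*-cong-%ʳ {c} (≈-sym ca≈cb))))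

  p∤k! : ∀ k → k < p → p ∤ k !
  p∤k! zero    _   = ∤-pos z<s 1<p
  p∤k! (suc k) k<p = ∤-* (∤-pos z<s k<p) (p∤k! k (<-trans (n<1+n k) k<p))

  p∣pCk : ∀ {k} → 0 < k → k < p → p ∣ p C k
  p∣pCk {k} 0<k k<p = ∣*∧∤⇒∣ˡ (subst (p ∣_) (sym pCk*k![p∸k]!≡p!) (m∣m*n (q !)))
    (∤-* (p∤k! k k<p) (p∤k! (p ∸ k) (∸-monoʳ-< 0<k (<⇒≤ k<p))))
    where
    pCk*k![p∸k]!≡p! : (p C k) * (k ! * (p ∸ k) !) ≡ p !
    pCk*k![p∸k]!≡p! = trans (cong (_* (k ! * (p ∸ k) !)) (nCk≡n!/k![n-k]! (<⇒≤ k<p)))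
                            (m/n*n≡m {{k !* (p ∸ k) !≢0}} (k![n∸k]!∣n! (<⇒≤ k<p)))

  [a+1]^p≈a^p+1 : ∀ a → (a + 1) ^ p ≈ a ^ p + 1
  [a+1]^p≈a^p+1 a = begin
    (a + 1) ^ p                           ≡⟨ binomial p a 1 ⟩
    Σ[ suc p ] term                       ≡⟨ cong (term F.zero +_) (Σ-init-last q (term ∘ F.suc)) ⟩
    term F.zero + (middle + term (fromℕ p)) ≡⟨ cong₂ (λ x y → x + (middle + y)) first last ⟩
    1 + (middle + a ^ p)                  ≈⟨ +-cong (≈-refl {1}) (+-cong (∣⇒≈0 p∣middle) (≈-refl {a ^ p})) ⟩
    1 + a ^ p                             ≡⟨ +-comm 1 (a ^ p) ⟩
    a ^ p + 1                             ∎
    where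
    open ≈-Reasoning
    term : Fin (suc p) → ℕ
    term k = (p C toℕ k) * (a ^ toℕ k * 1 ^ (p ∸ toℕ k))
    middle : ℕ
    middle = Σ[ q ] (term ∘ F.suc ∘ inject₁)
    p∣middle : p ∣ middle
    p∣middle = ∣-Σ q _ (λ i → ∣m⇒∣m*n _ (p∣pCk z<s (s≤s (FP.inject₁ℕ< i))))
    first : term F.zero ≡ 1
    first = trans (+-identityʳ _) (trans (*-identityˡ _) (^-zeroˡ p))
    last : term (fromℕ p) ≡ a ^ p
    last = trans (cong (λ k → (p C k) * (a ^ k * 1 ^ (p ∸ k))) (FP.toℕ-fromℕ p))
             (trans (cong₂ (λ c e → c * (a ^ p * 1 ^ e)) (nCn≡1 p) (n∸n≡0 p))
             (trans (*-identityˡ _) (*-identityʳ _)))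

  a^p≈a : ∀ a → a ^ p ≈ a
  a^p≈a zero    = ≈-refl
  a^p≈a (suc a) = begin
    suc a ^ p          ≡⟨ cong (_^ p) (+-comm 1 a) ⟩
    (a + 1) ^ p        ≈⟨ [a+1]^p≈a^p+1 a ⟩
    a ^ p + 1          ≈⟨ +-cong (a^p≈a a) (≈-refl {1}) ⟩
    a + 1              ≡⟨ +-comm a 1 ⟩
    suc a              ∎
    where open ≈-Reasoning

  a^[p∸1]≈1 : ∀ {a} → p ∤ a → a ^ (p ∸ 1) ≈ 1
  a^[p∸1]≈1 {a} p∤a =
    *-cancelˡ-≈ {a} {a ^ (p ∸ 1)} {1} p∤a (≈-trans (a^p≈a a) (≡⇒≈ (sym (*-identityʳ a))))

  powerSum : ℕ → ℕ
  powerSum k = Σ[ p ] (λ y → toℕ y ^ k)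

  powerSum-shift : ∀ k → Σ[ p ] (λ y → (toℕ y + 1) ^ suc k) ≈ powerSum (suc k)
  powerSum-shift k = begin
    Σ[ p ] (λ y → (toℕ y + 1) ^ suc k)      ≡⟨ Σ-cong p (λ y → cong (_^ suc k) (+-comm (toℕ y) 1)) ⟩
    0 + Σ[ p ] (λ y → suc (toℕ y) ^ suc k)  ≡⟨ Σ-shift p (_^ suc k) ⟩
    powerSum (suc k) + p ^ suc k            ≈⟨ +-cong (≈-refl {powerSum (suc k)}) (∣⇒≈0 (m∣m*n (p ^ k))) ⟩
    powerSum (suc k) + 0                    ≡⟨ +-identityʳ _ ⟩
    powerSum (suc k)                        ∎
    where open ≈-Reasoning

  powerSum-binomial : ∀ k →
    Σ[ p ] (λ y → (toℕ y + 1) ^ k) ≡ Σ[ suc k ] (λ j → (k C toℕ j) * powerSum (toℕ j))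
  powerSum-binomial k = begin
    Σ[ p ] (λ y → (toℕ y + 1) ^ k)              ≡⟨ Σ-cong p (λ y → binomial k (toℕ y) 1) ⟩
    Σ[ p ] (λ y → Σ[ suc k ] (term y))          ≡⟨ Σ-comm p (suc k) term ⟩
    Σ[ suc k ] (λ j → Σ[ p ] (λ y → term y j))  ≡⟨ Σ-cong (suc k) factor ⟩
    Σ[ suc k ] (λ j → (k C toℕ j) * powerSum (toℕ j)) ∎
    where
    open ≡-Reasoning
    term : Fin p → Fin (suc k) → ℕ
    term y j = (k C toℕ j) * (toℕ y ^ toℕ j * 1 ^ (k ∸ toℕ j))
    *1^e : ∀ a e → a * 1 ^ e ≡ a
    *1^e a e = trans (cong (a *_) (^-zeroˡ e)) (*-identityʳ a)
    factor : ∀ j → Σ[ p ] (λ y → term y j) ≡ (k C toℕ j) * powerSum (toℕ j)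
    factor j = trans (Σ-cong p (λ y → cong ((k C toℕ j) *_) (*1^e (toℕ y ^ toℕ j) (k ∸ toℕ j))))
                     (Σ-distribˡ-* p (k C toℕ j) (λ y → toℕ y ^ toℕ j))

  -- y ↦ y + 1 permutes ℤ_p, so Σ_y (y+1)^(k+1) ≡ Σ_y y^(k+1); expand the left side binomially.
  powerSum-recurrence : ∀ k → Σ[ k ] (λ j → (suc k C toℕ j) * powerSum (toℕ j)) + suc k * powerSum k ≈ 0
  powerSum-recurrence k = +-cancelʳ-≈ _ 0 (powerSum (suc k)) (begin
    lower + suc k * powerSum k + powerSum (suc k)  ≡⟨ split ⟨
    Σ[ suc (suc k) ] term                          ≡⟨ powerSum-binomial (suc k) ⟨
    Σ[ p ] (λ y → (toℕ y + 1) ^ suc k)             ≈⟨ powerSum-shift k ⟩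
    powerSum (suc k)                               ∎)
    where
    open ≈-Reasoning
    term : Fin (suc (suc k)) → ℕ
    term j = (suc k C toℕ j) * powerSum (toℕ j)
    lower : ℕ
    lower = Σ[ k ] (λ j → (suc k C toℕ j) * powerSum (toℕ j))
    lower≡ : Σ[ k ] (term ∘ inject₁ ∘ inject₁) ≡ lower
    lower≡ = Σ-cong k (λ j → cong (λ i → (suc k C i) * powerSum i)
                                  (trans (FP.toℕ-inject₁ _) (FP.toℕ-inject₁ j)))
    [k+1]Ck≡k+1 : (suc k C k) ≡ suc k
    [k+1]Ck≡k+1 = trans (nCk≡nC[n∸k] (n≤1+n k)) (trans (cong (suc k C_) (m+n∸n≡m 1 k)) (nC1≡n (suc k)))
    secondLast : term (inject₁ (fromℕ k)) ≡ suc k * powerSum k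
    secondLast = trans (cong (λ i → (suc k C i) * powerSum i)
                             (trans (FP.toℕ-inject₁ (fromℕ k)) (FP.toℕ-fromℕ k)))
                       (cong (_* powerSum k) [k+1]Ck≡k+1)
    last : term (fromℕ (suc k)) ≡ powerSum (suc k)
    last = trans (cong (λ i → (suc k C i) * powerSum i) (FP.toℕ-fromℕ (suc k)))
                 (trans (cong (_* powerSum (suc k)) (nCn≡1 (suc k))) (*-identityˡ _))
    split : Σ[ suc (suc k) ] term ≡ lower + suc k * powerSum k + powerSum (suc k)
    split = trans (Σ-init-last (suc k) term)
                  (cong₂ _+_ (trans (Σ-init-last k (term ∘ inject₁)) (cong₂ _+_ lower≡ secondLast)) last)

  p∣powerSum : ∀ k → k < p ∸ 1 → p ∣ powerSum k
  p∣powerSum = <-rec (λ k → k < p ∸ 1 → p ∣ powerSum k) step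
    where
    step : ∀ k → (∀ {j} → j < k → j < p ∸ 1 → p ∣ powerSum j) → k < p ∸ 1 → p ∣ powerSum k
    step k ih k<q =
      ∣*∧∤⇒∣ʳ (∣m+n∣m⇒∣n (≈0⇒∣ (powerSum-recurrence k)) p∣lower) (∤-pos z<s (s≤s k<q))
      where
      p∣lower : p ∣ Σ[ k ] (λ j → (suc k C toℕ j) * powerSum (toℕ j))
      p∣lower = ∣-Σ k _ (λ j → ∣n⇒∣m*n (suc k C toℕ j) (ih (FP.toℕ<n j) (<-trans (FP.toℕ<n j) k<q)))

  -- The Chevalley–Warning theorem

  Σcube : ∀ N → ((Fin N → ℕ) → ℕ) → ℕ
  Σcube zero    f = f (λ ())
  Σcube (suc N) f = Σ[ p ] (λ y → Σcube N (λ x → f (toℕ y Vec.∷ x)))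

  Σcube-cong : ∀ N {f g : (Fin N → ℕ) → ℕ} → (∀ x → f x ≡ g x) → Σcube N f ≡ Σcube N g
  Σcube-cong zero    f≗g = f≗g _
  Σcube-cong (suc N) f≗g = Σ-cong p (λ y → Σcube-cong N (λ x → f≗g (toℕ y Vec.∷ x)))

  Σcube-cong-≈ : ∀ N {f g : (Fin N → ℕ) → ℕ} → (∀ x → f x ≈ g x) → Σcube N f ≈ Σcube N g
  Σcube-cong-≈ zero    f≈g = f≈g _
  Σcube-cong-≈ (suc N) f≈g = Σ-cong-≈ p (λ y → Σcube-cong-≈ N (λ x → f≈g (toℕ y Vec.∷ x)))

  Σcube-zero : ∀ N → Σcube N (λ _ → 0) ≡ 0
  Σcube-zero zero    = refl
  Σcube-zero (suc N) = Σ-zero p _ (λ _ → Σcube-zero N)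

  Σcube-distrib-+ : ∀ N (f g : (Fin N → ℕ) → ℕ) → Σcube N (λ x → f x + g x) ≡ Σcube N f + Σcube N g
  Σcube-distrib-+ zero    f g = refl
  Σcube-distrib-+ (suc N) f g =
    trans (Σ-cong p (λ y → Σcube-distrib-+ N (f ∘ (toℕ y Vec.∷_)) (g ∘ (toℕ y Vec.∷_))))
          (Σ-distrib-+ p (λ y → Σcube N (f ∘ (toℕ y Vec.∷_))) (λ y → Σcube N (g ∘ (toℕ y Vec.∷_))))

  Σcube-distribˡ-* : ∀ N c (f : (Fin N → ℕ) → ℕ) → Σcube N (λ x → c * f x) ≡ c * Σcube N f
  Σcube-distribˡ-* zero    c f = refl
  Σcube-distribˡ-* (suc N) c f = trans (Σ-cong p (λ y → Σcube-distribˡ-* N c (f ∘ (toℕ y Vec.∷_))))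
                                       (Σ-distribˡ-* p c (λ y → Σcube N (f ∘ (toℕ y Vec.∷_))))

  Σcube-monomial : ∀ N (e : Fin N → ℕ) →
                   Σcube N (λ x → Π[ N ] (λ i → x i ^ e i)) ≡ Π[ N ] (powerSum ∘ e)
  Σcube-monomial zero    e = refl
  Σcube-monomial (suc N) e = trans
    (Σ-cong p (λ y → trans (Σcube-distribˡ-* N (toℕ y ^ e F.zero) _)
                           (cong (toℕ y ^ e F.zero *_) (Σcube-monomial N (e ∘ F.suc)))))
    (Σ-distribʳ-* p _ (λ y → toℕ y ^ e F.zero))

  -- Chevalley's lemma: a monomial of degree < N(p − 1) has some exponent e < p − 1.
  p∣Σcube⟦⟧ : ∀ N B (P : Polynomial N) → Deg≤ B P → B < N * (p ∸ 1) → p ∣ Σcube N ⟦ P ⟧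
  p∣Σcube⟦⟧ N B []                _             _ = subst (p ∣_) (sym (Σcube-zero N)) (p ∣0)
  p∣Σcube⟦⟧ N B ((c ·x^ e) ∷ P) (e≤B ∷ P≤B) B< =
    subst (p ∣_) (sym (Σcube-distrib-+ N ⟦ c ·x^ e ⟧ₘ ⟦ P ⟧))
                 (∣m∣n⇒∣m+n p∣Σcube-monomial (p∣Σcube⟦⟧ N B P P≤B B<))
    where
    smallExponent : ∃ λ i → e i < p ∸ 1
    smallExponent = Σ<*⇒∃< N (p ∸ 1) e (≤-<-trans e≤B B<)
    p∣Σcube-monomial : p ∣ Σcube N ⟦ c ·x^ e ⟧ₘ
    p∣Σcube-monomial = subst (p ∣_) (sym (trans (Σcube-distribˡ-* N c _) (cong (c *_) (Σcube-monomial N e))))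
      (∣n⇒∣m*n c (∣-Π N _ (proj₁ smallExponent) (p∣powerSum _ (proj₂ smallExponent))))

  IsOrigin : ∀ {N} → (Fin N → ℕ) → Set
  IsOrigin x = ∀ i → x i ≡ 0

  InCube : ∀ {N} → (Fin N → ℕ) → Set
  InCube x = ∀ i → x i < p

  ∷-isOrigin : ∀ {N} {x : Fin N → ℕ} → IsOrigin x → IsOrigin (0 Vec.∷ x)
  ∷-isOrigin x₀ F.zero    = refl
  ∷-isOrigin x₀ (F.suc i) = x₀ i

  ∷-inCube : ∀ {N a} {x : Fin N → ℕ} → a < p → InCube x → InCube (a Vec.∷ x)
  ∷-inCube a<p x∈cube F.zero    = a<p
  ∷-inCube a<p x∈cube (F.suc i) = x∈cube i

  Σcube-origin≤ : ∀ N (f : (Fin N → ℕ) → ℕ) {v} → (∀ x → IsOrigin x → v ≤ f x) → v ≤ Σcube N f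
  Σcube-origin≤ zero    f v≤f₀ = v≤f₀ _ (λ ())
  Σcube-origin≤ (suc N) f v≤f₀ = ≤-trans (Σcube-origin≤ N _ (λ x x₀ → v≤f₀ _ (∷-isOrigin x₀))) (m≤m+n _ _)

  Σcube-positive : ∀ N (f : (Fin N → ℕ) → ℕ) → 0 < Σcube N f → ∃ λ x → InCube x × 0 < f x
  Σcube-positive zero    f Σf>0 = (λ ()) , (λ ()) , Σf>0
  Σcube-positive (suc N) f Σf>0 with Σ-positive p _ Σf>0
  ... | y , Σfy>0 with Σcube-positive N _ Σfy>0
  ...   | x , x∈cube , fx>0 = (toℕ y Vec.∷ x) , ∷-inCube (FP.toℕ<n y) x∈cube , fx>0

  Σcube-beyondOrigin : ∀ N (f : (Fin N → ℕ) → ℕ) {v} → (∀ x → IsOrigin x → f x ≤ v) → v < Σcube N f →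
                       ∃ λ x → InCube x × (∃ λ i → 0 < x i) × 0 < f x
  Σcube-beyondOrigin zero    f f₀≤v v<Σf = contradiction (f₀≤v _ (λ ())) (<⇒≱ v<Σf)
  Σcube-beyondOrigin (suc N) f {v} f₀≤v v<Σf with v <? Σcube N (f ∘ (0 Vec.∷_))
  ... | yes v<Σf₀ with Σcube-beyondOrigin N (f ∘ (0 Vec.∷_)) (λ x x₀ → f₀≤v _ (∷-isOrigin x₀)) v<Σf₀
  ...   | x , x∈cube , (i , xi>0) , fx>0 = (0 Vec.∷ x) , ∷-inCube z<s x∈cube , (F.suc i , xi>0) , fx>0
  Σcube-beyondOrigin (suc N) f {v} f₀≤v v<Σf | no v≮Σf₀ with Σ-positive q _ rest>0
    where
    rest : ℕ
    rest = Σ[ q ] (λ y → Σcube N (f ∘ (toℕ (F.suc y) Vec.∷_)))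
    rest>0 : 0 < rest
    rest>0 = n≢0⇒n>0 λ rest≡0 → <⇒≱ v<Σf
      (≤-trans (≤-reflexive (trans (cong (Σcube N (f ∘ (0 Vec.∷_)) +_) rest≡0) (+-identityʳ _)))
               (≮⇒≥ v≮Σf₀))
  ... | y , Σfy>0 with Σcube-positive N _ Σfy>0
  ...   | x , x∈cube , fx>0 =
    (toℕ (F.suc y) Vec.∷ x) , ∷-inCube (FP.toℕ<n (F.suc y)) x∈cube , (F.zero , z<s) , fx>0

  instance
    p∸1≢0 : NonZero (p ∸ 1)
    p∸1≢0 = >-nonZero (s≤s⁻¹ 1<p)

  -- 1 − a^(p−1), written without truncated subtraction.
  indicator : ℕ → ℕ
  indicator a = 1 + (p ∸ 1) * a ^ (p ∸ 1)

  indicator-root : ∀ {a} → a ≈ 0 → indicator a ≈ 1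
  indicator-root {a} a≈0 = begin
    1 + q * a ^ q      ≈⟨ +-cong (≈-refl {1}) (*-cong (≈-refl {q}) (^-cong q a≈0)) ⟩
    1 + q * 0 ^ q      ≡⟨ cong (λ z → 1 + q * z) 0^q≡0 ⟩
    1 + q * 0          ≡⟨ cong suc (*-zeroʳ q) ⟩
    1                  ∎
    where
    open ≈-Reasoning
    0^q≡0 : 0 ^ q ≡ 0
    0^q≡0 = subst (λ n → 0 ^ n ≡ 0) (suc-pred q) refl

  indicator-nonroot : ∀ {a} → ¬ a ≈ 0 → indicator a ≈ 0
  indicator-nonroot {a} a≉0 = begin
    1 + q * a ^ q      ≈⟨ +-cong (≈-refl {1}) (*-cong (≈-refl {q}) (a^[p∸1]≈1 (a≉0 ∘ ∣⇒≈0))) ⟩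
    1 + q * 1          ≡⟨ cong suc (*-identityʳ q) ⟩
    p                  ≈⟨ ∣⇒≈0 ∣-refl ⟩
    0                  ∎
    where open ≈-Reasoning

  indicatorᵖ : ∀ {N} → Polynomial N → Polynomial N
  indicatorᵖ P = 1ᵖ ++ ((p ∸ 1) ·ᵖ (P ^ᵖ (p ∸ 1)))

  ⟦indicatorᵖ⟧ : ∀ {N} (P : Polynomial N) x → ⟦ indicatorᵖ P ⟧ x ≡ indicator (⟦ P ⟧ x)
  ⟦indicatorᵖ⟧ P x = begin
    ⟦ 1ᵖ ++ (q ·ᵖ (P ^ᵖ q)) ⟧ x      ≡⟨ ⟦++⟧ 1ᵖ (q ·ᵖ (P ^ᵖ q)) x ⟩
    ⟦ 1ᵖ ⟧ x + ⟦ q ·ᵖ (P ^ᵖ q) ⟧ x   ≡⟨ cong₂ _+_ (⟦1ᵖ⟧ x) (⟦·ᵖ⟧ q (P ^ᵖ q) x) ⟩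
    1 + q * ⟦ P ^ᵖ q ⟧ x             ≡⟨ cong (λ z → 1 + q * z) (⟦^ᵖ⟧ P q x) ⟩
    1 + q * ⟦ P ⟧ x ^ q              ∎
    where open ≡-Reasoning

  Deg≤-indicatorᵖ : ∀ {N B} {P : Polynomial N} → Deg≤ B P → Deg≤ ((p ∸ 1) * B) (indicatorᵖ P)
  Deg≤-indicatorᵖ P≤B = Deg≤-++ (Deg≤-1ᵖ _) (Deg≤-·ᵖ (p ∸ 1) (Deg≤-^ᵖ (p ∸ 1) P≤B))

  p∣Σcube-indicators : ∀ {N d} (Ps : Fin d → Polynomial N) (B : Fin d → ℕ) →
    (∀ k → Deg≤ (B k) (Ps k)) → Σ[ d ] B < N → p ∣ Σcube N (λ x → Π[ d ] (λ k → indicator (⟦ Ps k ⟧ x)))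
  p∣Σcube-indicators {N} {d} Ps B Ps≤B ΣB<N = subst (p ∣_) (Σcube-cong N ⟦Π⟧≡)
    (p∣Σcube⟦⟧ N _ (Πᵖ[ d ] (indicatorᵖ ∘ Ps)) (Deg≤-Πᵖ d _ _ (Deg≤-indicatorᵖ ∘ Ps≤B)) deg<)
    where
    ⟦Π⟧≡ : ∀ x → ⟦ Πᵖ[ d ] (indicatorᵖ ∘ Ps) ⟧ x ≡ Π[ d ] (λ k → indicator (⟦ Ps k ⟧ x))
    ⟦Π⟧≡ x = trans (⟦Πᵖ⟧ d _ x) (Π-cong d (λ k → ⟦indicatorᵖ⟧ (Ps k) x))
    deg< : Σ[ d ] (λ k → (p ∸ 1) * B k) < N * (p ∸ 1)
    deg< = begin-strict
      Σ[ d ] (λ k → q * B k)   ≡⟨ Σ-distribˡ-* d q B ⟩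
      q * Σ[ d ] B             <⟨ *-monoʳ-< q ΣB<N ⟩
      q * N                    ≡⟨ *-comm q N ⟩
      N * q                    ∎
      where open ≤-Reasoning

  chevalleyWarning : ∀ {N d} (Ps : Fin d → Polynomial N) (B : Fin d → ℕ) →
    (∀ k → Deg≤ (B k) (Ps k)) → Σ[ d ] B < N → (∀ k → ⟦ Ps k ⟧ (λ _ → 0) ≈ 0) →
    ∃ λ x → InCube x × (∃ λ i → 0 < x i) × (∀ k → ⟦ Ps k ⟧ x ≈ 0)
  chevalleyWarning {N} {d} Ps B Ps≤B ΣB<N Ps₀≈0
    with Σcube-beyondOrigin N f (λ x x₀ → ≤-reflexive (f₀≡1 x x₀)) 1<Σf
    where
    I : (Fin N → ℕ) → ℕ
    I x = Π[ d ] (λ k → indicator (⟦ Ps k ⟧ x))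
    f : (Fin N → ℕ) → ℕ
    f x = I x % p
    f₀≡1 : ∀ x → IsOrigin x → f x ≡ 1
    f₀≡1 x x₀ = trans (%≡% (≈-trans (Π-cong-≈ d root) (≡⇒≈ (Π-one d _ (λ _ → refl))))) (m<n⇒m%n≡m 1<p)
      where
      root : ∀ k → indicator (⟦ Ps k ⟧ x) ≈ 1
      root k = indicator-root (≈-trans (≡⇒≈ (⟦⟧-cong (Ps k) x₀)) (Ps₀≈0 k))
    Σf≈0 : Σcube N f ≈ 0
    Σf≈0 = ≈-trans (Σcube-cong-≈ N (λ x → %-≈ (I x))) (∣⇒≈0 (p∣Σcube-indicators Ps B Ps≤B ΣB<N))
    1<Σf : 1 < Σcube N f
    1<Σf = ≤∧≢⇒< (Σcube-origin≤ N f (λ x x₀ → ≤-reflexive (sym (f₀≡1 x x₀))))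
                 (λ 1≡Σf → 1≉0 (subst (_≈ 0) (sym 1≡Σf) Σf≈0))
  ... | x , x∈cube , x≢0 , fx>0 = x , x∈cube , x≢0 , commonRoot
    where
    commonRoot : ∀ k → ⟦ Ps k ⟧ x ≈ 0
    commonRoot k with ⟦ Ps k ⟧ x ≈? 0
    ... | yes root = root
    ... | no  nonroot = contradiction (%≡% (∣⇒≈0 p∣Ix)) (>⇒≢ fx>0)
      where
      p∣Ix : p ∣ Π[ d ] (λ k → indicator (⟦ Ps k ⟧ x))
      p∣Ix = ∣-Π d _ k (≈0⇒∣ (indicator-nonroot nonroot))

  -- Quadratic residues

  ∤⇒invertible : ∀ {y} → p ∤ y → ∃ λ u → y * u ≈ 1
  ∤⇒invertible {y} p∤y =
    y ^ pred (p ∸ 1) , ≈-trans (≡⇒≈ (cong (y ^_) (suc-pred (p ∸ 1)))) (a^[p∸1]≈1 p∤y)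

  IsSquare : ℕ → Set
  IsSquare a = ∃ λ m → a ≈ m * m

  nonSquare⇒∤ : ∀ {a} → ¬ IsSquare a → p ∤ a
  nonSquare⇒∤ a∉□ p∣a = a∉□ (0 , ∣⇒≈0 p∣a)

  nonSquare*square : ∀ {n y} → ¬ IsSquare n → p ∤ y → ¬ IsSquare (n * (y * y))
  nonSquare*square {n} {y} n∉□ p∤y (m , ny²≈m²) with ∤⇒invertible p∤y
  ... | u , yu≈1 = n∉□ (m * u , (begin
    n                          ≡⟨ *-identityʳ n ⟨
    n * 1                      ≈⟨ *-cong (≈-refl {n}) (*-cong yu≈1 yu≈1) ⟨
    n * ((y * u) * (y * u))    ≡⟨ regroup n y u ⟩
    n * (y * y) * (u * u)      ≈⟨ *-cong ny²≈m² (≈-refl {u * u}) ⟩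
    m * m * (u * u)            ≡⟨ *-interchange m m u u ⟩
    m * u * (m * u)            ∎))
    where
    open ≈-Reasoning
    regroup : ∀ n y u → n * ((y * u) * (y * u)) ≡ n * (y * y) * (u * u)
    regroup = solve-∀

  representative : ∀ m → ∃ λ w → 1 ≤ w × w ≤ p × w ≈ m
  representative m with m % p ≟ 0
  ... | yes m%p≡0 = p , s≤s z≤n , ≤-refl , mk≈ (trans (n%n≡0 p) (sym m%p≡0))
  ... | no  m%p≢0 = m % p , n≢0⇒n>0 m%p≢0 , m%n≤n m p , %-≈ m

  A₂⇒nonSquare : ∀ {a} → A₂ p a → ¬ IsSquare a
  A₂⇒nonSquare (_ , _ , a≢w²) (m , a≈m²) with representative m
  ... | w , 1≤w , w≤p , w≈m = a≢w² w 1≤w w≤p (%≡% (≈-trans a≈m² (*-cong (≈-sym w≈m) (≈-sym w≈m))))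

  nonSquare⇒A₂ : ∀ {a} → ¬ IsSquare a → A₂ p (a % p)
  nonSquare⇒A₂ {a} a∉□ =
    ∤⇒%>0 (nonSquare⇒∤ a∉□) , s≤s⁻¹ (m%n<n a p) ,
    λ x _ _ a%p≡x² → a∉□ (x , mk≈ (trans (sym (m%n%n≡m%n a p)) a%p≡x²))

  diagonalRoot⇒zeroSum : ∀ {t d n} (g : Fin t → ZpD p d) → A₂ p n → (x : Fin t → ℕ) → InCube x →
    (∃ λ i → 0 < x i) → (∀ k → Σ[ t ] (λ i → toℕ (g i k) * x i ^ 2) ≈ 0) →
    HasAZeroSum (A₂ p) p d t g
  diagonalRoot⇒zeroSum {t} {d} {n} g n∈A₂ x x∈cube (i₀ , xᵢ₀>0) Σgx²≈0 =
    S , weight , (i₀ , positive⇒selected xᵢ₀>0) , weight∈A₂ , zeroSum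
    where
    isPositive : ℕ → Bool
    isPositive zero    = false
    isPositive (suc _) = true
    positive⇒selected : ∀ {m} → 0 < m → isPositive m ≡ true
    positive⇒selected {suc _} _ = refl
    S : Fin t → Bool
    S i = isPositive (x i)
    weight : Fin t → ℕ
    weight i = (n * (x i * x i)) % p
    weight∈A₂ : ∀ i → S i ≡ true → A₂ p (weight i)
    weight∈A₂ i Sᵢ with x i | x∈cube i
    ... | suc m | m<p = nonSquare⇒A₂ (nonSquare*square (A₂⇒nonSquare n∈A₂) (∤-pos z<s m<p))
    term : ∀ m c → sel (isPositive m) ((n * (m * m)) % p) * c ≈ n * (c * m ^ 2)
    term zero    c = ≡⇒≈ (sym (trans (cong (n *_) (*-zeroʳ c)) (*-zeroʳ n)))
    term (suc m) c = ≈-trans (*-cong (%-≈ (n * (suc m * suc m))) (≈-refl {c})) (≡⇒≈ (regroup n (suc m) c))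
      where
      regroup : ∀ n m c → n * (m * m) * c ≡ n * (c * (m * (m * 1)))
      regroup = solve-∀
    zeroSum : ∀ k → Σ[ t ] (λ i → sel (S i) (weight i) * toℕ (g i k)) % p ≡ 0
    zeroSum k = %≡% (begin
      Σ[ t ] (λ i → sel (S i) (weight i) * toℕ (g i k))   ≈⟨ Σ-cong-≈ t (λ i → term (x i) (toℕ (g i k))) ⟩
      Σ[ t ] (λ i → n * (toℕ (g i k) * x i ^ 2))          ≡⟨ Σ-distribˡ-* t n _ ⟩
      n * Σ[ t ] (λ i → toℕ (g i k) * x i ^ 2)            ≈⟨ *-cong (≈-refl {n}) (Σgx²≈0 k) ⟩
      n * 0                                               ≡⟨ *-zeroʳ n ⟩
      0                                                   ∎)
      where open ≈-Reasoning

  upperBound : ∀ d {n} → A₂ p n → AllHaveAZeroSum (A₂ p) p d (2 * d + 1)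
  upperBound d n∈A₂ g with chevalleyWarning Qs (λ _ → 2) (Deg≤-diagonalForm ∘ coeff) ΣB<N Qs₀≈0
    where
    coeff : Fin d → Fin (2 * d + 1) → ℕ
    coeff k i = toℕ (g i k)
    Qs : Fin d → Polynomial (2 * d + 1)
    Qs k = diagonalForm (coeff k)
    ΣB<N : Σ[ d ] (λ _ → 2) < 2 * d + 1
    ΣB<N = subst (_< 2 * d + 1) (trans (*-comm 2 d) (sym (Σ-const d 2))) (m<m+n (2 * d) z<s)
    Qs₀≈0 : ∀ k → ⟦ Qs k ⟧ (λ _ → 0) ≈ 0
    Qs₀≈0 k = ≡⇒≈ (trans (⟦diagonalForm⟧ (coeff k) _) (Σ-zero _ _ (λ i → *-zeroʳ (coeff k i))))
  ... | x , x∈cube , x≢0 , Qsx≈0 =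
    diagonalRoot⇒zeroSum g n∈A₂ x x∈cube x≢0 (λ k → ≈-trans (≡⇒≈ (sym (⟦diagonalForm⟧ _ x))) (Qsx≈0 k))

module QuadraticResidues (h : ℕ) (pp : Prime (suc (h + h))) where

  open PrimeModulus (h + h) pp public

  0<h : 0 < h
  0<h = n≢0⇒n>0 λ h≡0 → <-irrefl (cong (λ k → suc (k + k)) (sym h≡0)) 1<p

  root : Fin h → ℕ
  root z = suc (toℕ z)

  p∤root : ∀ z → p ∤ root z
  p∤root z = ∤-pos z<s (s≤s (≤-trans (FP.toℕ<n z) (m≤m+n h h)))

  square-injective-≤ : ∀ {y z} → 0 < y → z ≤ y → y + z < p → y * y ≈ z * z → y ≡ z
  square-injective-≤ {y} {z} 0<y z≤y y+z<p y²≈z² = ≤-antisym (m∸n≡0⇒m≤n y∸z≡0) z≤y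
    where
    open ≡-Reasoning
    square-+ : ∀ z k → (z + k) * (z + k) ≡ z * z + k * ((z + k) + z)
    square-+ = solve-∀
    expand : y * y ≡ z * z + (y ∸ z) * (y + z)
    expand = begin
      y * y                                ≡⟨ cong (λ a → a * a) (m+[n∸m]≡n z≤y) ⟨
      (z + (y ∸ z)) * (z + (y ∸ z))        ≡⟨ square-+ z (y ∸ z) ⟩
      z * z + (y ∸ z) * (z + (y ∸ z) + z)  ≡⟨ cong (λ a → z * z + (y ∸ z) * (a + z)) (m+[n∸m]≡n z≤y) ⟩
      z * z + (y ∸ z) * (y + z)            ∎
    p∣[y∸z][y+z] : p ∣ (y ∸ z) * (y + z)
    p∣[y∸z][y+z] = subst (p ∣_) (trans (cong (_∸ z * z) expand) (m+n∸m≡n (z * z) _))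
      (≤∧≈⇒∣∸ (*-mono-≤ z≤y z≤y) (≈-sym y²≈z²))
    y∸z≡0 : y ∸ z ≡ 0
    y∸z≡0 = ∣∧<⇒≡0 (∣*∧∤⇒∣ˡ p∣[y∸z][y+z] (∤-pos (<-≤-trans 0<y (m≤m+n y z)) y+z<p))
                   (≤-<-trans (m∸n≤m y z) (≤-<-trans (m≤m+n y z) y+z<p))

  square-injective : ∀ {y z} → 0 < y → 0 < z → y + z < p → y * y ≈ z * z → y ≡ z
  square-injective {y} {z} 0<y 0<z y+z<p y²≈z² with ≤-total z y
  ... | inj₁ z≤y = square-injective-≤ 0<y z≤y y+z<p y²≈z²
  ... | inj₂ y≤z = sym (square-injective-≤ 0<z y≤z (subst (_< p) (+-comm y z) y+z<p) (≈-sym y²≈z²))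

  root²-injective : ∀ {y z} → root y * root y ≈ root z * root z → y ≡ z
  root²-injective {y} {z} y²≈z² =
    FP.toℕ-injective (suc-injective
      (square-injective z<s z<s (s≤s (+-mono-≤ (FP.toℕ<n y) (FP.toℕ<n z))) y²≈z²))

  toRoot : ∀ {y} → 0 < y → y ≤ h → ∃ λ z → root z ≡ y
  toRoot {suc y} _ y<h = fromℕ< y<h , cong suc (FP.toℕ-fromℕ< y<h)

  squareRoot : ∀ {y} → 0 < y → y < p → ∃ λ z → y * y ≈ root z * root z
  squareRoot {y} 0<y y<p with y ≤? h
  ... | yes y≤h = let z , root≡y = toRoot 0<y y≤h in z , ≡⇒≈ (cong (λ a → a * a) (sym root≡y))
  ... | no  y≰h = let z , root≡p∸y = toRoot (m<n⇒0<n∸m y<p) p∸y≤h in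
    z , ≈-trans (≈-sym ([m∸y]²≈y² (<⇒≤ y<p))) (≡⇒≈ (cong (λ a → a * a) (sym root≡p∸y)))
    where
    p∸y≤h : p ∸ y ≤ h
    p∸y≤h = ≤-trans (∸-monoʳ-≤ p (≰⇒> y≰h)) (≤-reflexive (m+n∸m≡n h h))

  isSquare⇒root : ∀ {a} → p ∤ a → IsSquare a → ∃ λ z → a ≈ root z * root z
  isSquare⇒root {a} p∤a (m , a≈m²) =
    let z , m%p²≈z² = squareRoot (∤⇒%>0 p∤m) (m%n<n m p) in
    z , ≈-trans a≈m² (≈-trans (*-cong (≈-sym (%-≈ m)) (≈-sym (%-≈ m))) m%p²≈z²)
    where
    p∤m : p ∤ m
    p∤m p∣m = p∤a (≈0⇒∣ (≈-trans a≈m² (*-cong (∣⇒≈0 p∣m) (∣⇒≈0 p∣m))))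

  -- Every nonzero square is one of the h numbers 1², …, h², but there are 2h nonzero residues.
  ∃nonSquare : ∃ λ a → ¬ IsSquare a
  ∃nonSquare
    with FP.¬∀⟶∃¬ (h + h) RootExists (λ a → FP.any? (λ z → suc (toℕ a) ≈? root z * root z)) notAll
    where
    RootExists : Fin (h + h) → Set
    RootExists a = ∃ λ z → suc (toℕ a) ≈ root z * root z
    notAll : ¬ (∀ a → RootExists a)
    notAll rootOf with FP.pigeonhole (m<m+n h 0<h) (proj₁ ∘ rootOf)
    ... | a , b , a<b , sameRoot =
      <-irrefl (suc-injective (≈∧<⇒≡ a≈b (s≤s (FP.toℕ<n a)) (s≤s (FP.toℕ<n b)))) a<b
      where
      a≈b : suc (toℕ a) ≈ suc (toℕ b)
      a≈b = ≈-trans (proj₂ (rootOf a))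
              (≈-trans (≡⇒≈ (cong (λ z → root z * root z) sameRoot)) (≈-sym (proj₂ (rootOf b))))
  ... | a , noRoot = suc (toℕ a) , noRoot ∘ isSquare⇒root (∤-pos z<s (s≤s (FP.toℕ<n a)))

  -- Otherwise b, the h squares z² and the h non-squares a z² would be 2h + 1 distinct nonzero residues.
  nonSquare-coset : ∀ {a b} → ¬ IsSquare a → ¬ IsSquare b → ∃ λ z → b ≈ a * (root z * root z)
  nonSquare-coset {a} {b} a∉□ b∉□ with FP.any? (λ z → b ≈? a * (root z * root z))
  ... | yes inCoset = inCoset
  ... | no  b∉a□ = ⊥-elim (noCollision (pigeonhole-ℕ (h + h) (λ i → value i % p) residue∈[1,p∸1]))
    where
    value : Fin (suc (h + h)) → ℕ
    value F.zero    = b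
    value (F.suc i) = [ (λ z → root z * root z) , (λ z → a * (root z * root z)) ]′ (F.splitAt h i)
    p∤value : ∀ i → p ∤ value i
    p∤value F.zero = nonSquare⇒∤ b∉□
    p∤value (F.suc i) with F.splitAt h i
    ... | inj₁ z = ∤-* (p∤root z) (p∤root z)
    ... | inj₂ z = ∤-* (nonSquare⇒∤ a∉□) (∤-* (p∤root z) (p∤root z))
    residue∈[1,p∸1] : ∀ i → 0 < value i % p × value i % p ≤ h + h
    residue∈[1,p∸1] i = ∤⇒%>0 (p∤value i) , s≤s⁻¹ (m%n<n (value i) p)
    distinct : ∀ {i j} → i F.< j → F.splitAt h i ≢ F.splitAt h j
    distinct i<j same = <-irrefl (cong toℕ (splitAt-injective h same)) i<j
    noCollision : (∃₂ λ i j → i F.< j × value i % p ≡ value j % p) → ⊥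
    noCollision (F.zero , F.suc j , _ , b≈vⱼ) with F.splitAt h j
    ... | inj₁ z = b∉□ (root z , mk≈ b≈vⱼ)
    ... | inj₂ z = b∉a□ (z , mk≈ b≈vⱼ)
    noCollision (F.suc i , F.suc j , i<j , vᵢ≈vⱼ) with F.splitAt h i in splitᵢ | F.splitAt h j in splitⱼ
    ... | inj₁ y | inj₁ z = distinct (s≤s⁻¹ i<j) (trans splitᵢ (trans (cong inj₁ y≡z) (sym splitⱼ)))
      where
      y≡z : y ≡ z
      y≡z = root²-injective (mk≈ vᵢ≈vⱼ)
    ... | inj₁ y | inj₂ z = nonSquare*square a∉□ (p∤root z) (root y , ≈-sym (mk≈ vᵢ≈vⱼ))
    ... | inj₂ y | inj₁ z = nonSquare*square a∉□ (p∤root y) (root z , mk≈ vᵢ≈vⱼ)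
    ... | inj₂ y | inj₂ z = distinct (s≤s⁻¹ i<j) (trans splitᵢ (trans (cong inj₂ y≡z) (sym splitⱼ)))
      where
      y≡z : y ≡ z
      y≡z = root²-injective (*-cancelˡ-≈ (nonSquare⇒∤ a∉□) (mk≈ vᵢ≈vⱼ))

  nonSquare*nonSquare : ∀ {a b} → ¬ IsSquare a → ¬ IsSquare b → IsSquare (a * b)
  nonSquare*nonSquare {a} a∉□ b∉□ =
    let z , b≈az² = nonSquare-coset a∉□ b∉□ in
    a * root z , ≈-trans (*-cong (≈-refl {a}) b≈az²) (≡⇒≈ (regroup a (root z)))
    where
    regroup : ∀ a r → a * (a * (r * r)) ≡ a * r * (a * r)
    regroup = solve-∀

  A₂⇒∤ : ∀ {a} → A₂ p a → p ∤ a
  A₂⇒∤ = nonSquare⇒∤ ∘ A₂⇒nonSquare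

  A₂⇒<p : ∀ {a} → A₂ p a → a < p
  A₂⇒<p (_ , a≤p∸1 , _) = s≤s a≤p∸1

  p∸A₂<p : ∀ {a} → A₂ p a → p ∸ a < p
  p∸A₂<p a∈A₂ = ∸-monoʳ-< (proj₁ a∈A₂) (<⇒≤ (A₂⇒<p a∈A₂))

  noWeightedPair : ∀ {n a b} → A₂ p n → A₂ p a → A₂ p b → ¬ a + b * (p ∸ n) ≈ 0
  noWeightedPair {n} {a} {b} n∈A₂ a∈A₂ b∈A₂ a+b[p∸n]≈0
    with nonSquare*nonSquare (A₂⇒nonSquare b∈A₂) (A₂⇒nonSquare n∈A₂)
  ... | m , bn≈m² = A₂⇒nonSquare a∈A₂ (m , ≈-trans a≈bn bn≈m²)
    where
    open ≈-Reasoning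
    a≈bn : a ≈ b * n
    a≈bn = begin
      a                            ≡⟨ +-identityʳ a ⟨
      a + 0                        ≈⟨ +-cong (≈-refl {a}) (∣⇒≈0 (n∣m*n b)) ⟨
      a + b * p                    ≡⟨ cong (λ c → a + b * c) (m∸n+n≡m (<⇒≤ (A₂⇒<p n∈A₂))) ⟨
      a + b * (p ∸ n + n)          ≡⟨ trans (cong (a +_) (*-distribˡ-+ b _ n)) (sym (+-assoc a _ _)) ⟩
      a + b * (p ∸ n) + b * n      ≈⟨ +-cong a+b[p∸n]≈0 (≈-refl {b * n}) ⟩
      b * n                        ∎

  noSelectedPair : ∀ {n} → A₂ p n → ∀ su sv {au av} → (su ≡ true → A₂ p au) → (sv ≡ true → A₂ p av) →
                   su ≡ true ⊎ sv ≡ true → ¬ sel su au * 1 + sel sv av * (p ∸ n) ≈ 0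
  noSelectedPair n∈A₂ true  true  {au} au∈A₂ av∈A₂ _ =
    noWeightedPair n∈A₂ (au∈A₂ refl) (av∈A₂ refl) ∘ ≈-trans (≡⇒≈ (cong (_+ _) (sym (*-identityʳ au))))
  noSelectedPair n∈A₂ true  false {au} au∈A₂ _ _ =
    A₂⇒∤ (au∈A₂ refl) ∘ ≈0⇒∣ ∘ ≈-trans (≡⇒≈ (sym (trans (+-identityʳ _) (*-identityʳ au))))
  noSelectedPair {n} n∈A₂ false true {_} {av} _ av∈A₂ _ =
    ∤-* (A₂⇒∤ (av∈A₂ refl)) (∤-pos (m<n⇒0<n∸m (A₂⇒<p n∈A₂)) (p∸A₂<p n∈A₂)) ∘ ≈0⇒∣
  noSelectedPair n∈A₂ false false _ _ (inj₁ ())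
  noSelectedPair n∈A₂ false false _ _ (inj₂ ())

  pairCoefficient : Fin p → Fin 2 → Fin p
  pairCoefficient r F.zero         = fromℕ< 1<p
  pairCoefficient r (F.suc F.zero) = r

  -- Entry combine 0 k is e_k and entry combine 1 k is r e_k.
  pairSequence : ∀ d → Fin p → Fin (2 * d) → ZpD p d
  pairSequence d r i = onlyAt F.zero (proj₂ (F.remQuot {2} d i)) (pairCoefficient r (proj₁ (F.remQuot {2} d i)))

  pairSequence-combine : ∀ d r (j : Fin 2) (k : Fin d) → pairSequence d r (F.combine j k) k ≡ pairCoefficient r j
  pairSequence-combine d r j k =
    trans (cong (λ (j′ , k′) → onlyAt F.zero k′ (pairCoefficient r j′) k) (FP.remQuot-combine j k))
          (onlyAt-here F.zero k _)

  pairSequence-coordinate : ∀ d r (w : Fin (2 * d) → ℕ) k →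
    Σ[ 2 * d ] (λ i → w i * toℕ (pairSequence d r i k))
      ≡ w (F.combine {2} F.zero k) * 1 + w (F.combine {2} (F.suc F.zero) k) * toℕ r
  pairSequence-coordinate d r w k = trans (Σ-pair (2 * d) _ (first k) (second k) first≢second others)
    (cong₂ _+_ (cong (w (first k) *_) (trans (cong toℕ (pairSequence-combine d r F.zero k)) (FP.toℕ-fromℕ< 1<p)))
               (cong (λ c → w (second k) * toℕ c) (pairSequence-combine d r (F.suc F.zero) k)))
    where
    first second : Fin d → Fin (2 * d)
    first  = F.combine {2} F.zero
    second = F.combine {2} (F.suc F.zero)
    first≢second : first k ≢ second k
    first≢second same with FP.combine-injective {2} F.zero k (F.suc F.zero) k same
    ... | () , _
    others : ∀ i → i ≢ first k → i ≢ second k → w i * toℕ (pairSequence d r i k) ≡ 0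
    others i i≢first i≢second =
      trans (cong (λ c → w i * toℕ c) (onlyAt-elsewhere F.zero _ _ k k≢k′)) (*-zeroʳ (w i))
      where
      k≢k′ : k ≢ proj₂ (F.remQuot {2} d i)
      k≢k′ k≡k′ = [ i≢first , i≢second ]′
        (subst (λ k′ → i ≡ first k′ ⊎ i ≡ second k′) (sym k≡k′) (combine-remQuot-2 d i))

  nonResidue : ∃ (A₂ p)
  nonResidue = let a , a∉□ = ∃nonSquare in a % p , nonSquare⇒A₂ a∉□

  lowerBound : ∀ d → ∃ λ (g : Fin (2 * d) → ZpD p d) → ¬ HasAZeroSum (A₂ p) p d (2 * d) g
  lowerBound d = pairSequence d r , noZeroSum
    where
    n∈A₂ : A₂ p (proj₁ nonResidue)
    n∈A₂ = proj₂ nonResidue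
    r : Fin p
    r = fromℕ< (p∸A₂<p n∈A₂)
    noZeroSum : ¬ HasAZeroSum (A₂ p) p d (2 * d) (pairSequence d r)
    noZeroSum (S , a , (i₀ , Sᵢ₀) , a∈A₂ , zeroSum) =
      noSelectedPair n∈A₂ (S first) (S second) (a∈A₂ first) (a∈A₂ second) selected
        (mk≈ (trans (cong (_% p) (sym coordinate)) (zeroSum k)))
      where
      k : Fin d
      k = proj₂ (F.remQuot {2} d i₀)
      first second : Fin (2 * d)
      first  = F.combine {2} F.zero k
      second = F.combine {2} (F.suc F.zero) k
      coordinate : Σ[ 2 * d ] (λ i → sel (S i) (a i) * toℕ (pairSequence d r i k))
                 ≡ sel (S first) (a first) * 1 + sel (S second) (a second) * (p ∸ proj₁ nonResidue)
      coordinate = trans (pairSequence-coordinate d r (λ i → sel (S i) (a i)) k)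
                         (cong (λ c → sel (S first) (a first) * 1 + sel (S second) (a second) * c)
                               (FP.toℕ-fromℕ< _))
      selected : S first ≡ true ⊎ S second ≡ true
      selected = ⊎-map selectedAt selectedAt (combine-remQuot-2 d i₀)
        where
        selectedAt : ∀ {i} → i₀ ≡ i → S i ≡ true
        selectedAt i₀≡i = subst (λ i → S i ≡ true) i₀≡i Sᵢ₀

module _ {A : ℕ → Set} {p d : ℕ} .{{_ : NonZero p}} where

  AllHaveAZeroSum-+ : ∀ t m → AllHaveAZeroSum A p d t → AllHaveAZeroSum A p d (t + m)
  AllHaveAZeroSum-+ t m allₜ g with allₜ (g ∘ (_↑ˡ m))
  ... | S , a , (i₀ , Sᵢ₀) , a∈A , zeroSum =
    extend S false , extend a 0 , (i₀ ↑ˡ m , trans (extend-↑ˡ S false i₀) Sᵢ₀) ,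
    extended∈A , extendedZeroSum
    where
    extend : ∀ {B : Set} → (Fin t → B) → B → Fin (t + m) → B
    extend f z i = [ f , (λ _ → z) ]′ (F.splitAt t i)
    extend-↑ˡ : ∀ {B : Set} (f : Fin t → B) z i → extend f z (i ↑ˡ m) ≡ f i
    extend-↑ˡ f z i = cong [ f , (λ _ → z) ]′ (FP.splitAt-↑ˡ t i m)
    extend-↑ʳ : ∀ {B : Set} (f : Fin t → B) z j → extend f z (t ↑ʳ j) ≡ z
    extend-↑ʳ f z j = cong [ f , (λ _ → z) ]′ (FP.splitAt-↑ʳ t m j)
    extended∈A : ∀ i → extend S false i ≡ true → A (extend a 0 i)
    extended∈A i with F.splitAt t i
    ... | inj₁ j = a∈A j
    ... | inj₂ j = λ ()
    term : Fin (t + m) → Fin d → ℕ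
    term i k = sel (extend S false i) (extend a 0 i) * toℕ (g i k)
    extendedZeroSum : ∀ k → Σ[ t + m ] (λ i → term i k) % p ≡ 0
    extendedZeroSum k = trans (cong (_% p) (begin
      Σ[ t + m ] (λ i → term i k)                                      ≡⟨ Σ-++ t m (λ i → term i k) ⟩
      Σ[ t ] (λ i → term (i ↑ˡ m) k) + Σ[ m ] (λ j → term (t ↑ʳ j) k)
        ≡⟨ cong₂ _+_ (Σ-cong t kept) (Σ-zero m _ dropped) ⟩
      Σ[ t ] (λ i → sel (S i) (a i) * toℕ (g (i ↑ˡ m) k)) + 0           ≡⟨ +-identityʳ _ ⟩
      Σ[ t ] (λ i → sel (S i) (a i) * toℕ (g (i ↑ˡ m) k))               ∎)) (zeroSum k)
      where
      open ≡-Reasoning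
      kept : ∀ i → term (i ↑ˡ m) k ≡ sel (S i) (a i) * toℕ (g (i ↑ˡ m) k)
      kept i = cong₂ (λ s w → sel s w * toℕ (g (i ↑ˡ m) k)) (extend-↑ˡ S false i) (extend-↑ˡ a 0 i)
      dropped : ∀ j → term (t ↑ʳ j) k ≡ 0
      dropped j = cong (λ s → sel s (extend a 0 (t ↑ʳ j)) * toℕ (g (t ↑ʳ j) k)) (extend-↑ʳ S false j)

  AllHaveAZeroSum-mono : ∀ {t u} → t ≤ u → AllHaveAZeroSum A p d t → AllHaveAZeroSum A p d u
  AllHaveAZeroSum-mono {t} {u} t≤u allₜ =
    subst (λ n → AllHaveAZeroSum A p d n) (m+[n∸m]≡n t≤u) (AllHaveAZeroSum-+ t (u ∸ t) allₜ)

oddPrime : ∀ {p} → Prime p → 2 < p → ∃ λ h → p ≡ suc (h + h)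
oddPrime {p} pp 2<p with p % 2 | m%n<n p 2 | m≡m%n+[m/n]*n p 2
... | 0           | _               | p≡[p/2]*2   with prime⇒irreducible pp (divides (p / 2) p≡[p/2]*2)
...   | inj₁ ()
...   | inj₂ 2≡p = contradiction 2≡p (<⇒≢ 2<p)
oddPrime {p} pp 2<p | 1 | _ | p≡1+[p/2]*2 =
  p / 2 , trans p≡1+[p/2]*2 (cong suc (trans (*-comm (p / 2) 2) (cong (p / 2 +_) (+-identityʳ (p / 2)))))
oddPrime {p} pp 2<p | suc (suc _) | s≤s (s≤s ()) | _

corollary1p2 : (p : ℕ) → (pp : Prime p) → 2 < p → (d : ℕ) → 1 ≤ d →
    DavenportA≡ (A₂ p {{prime⇒nonZero pp}}) p d (2 * d + 1) {{prime⇒nonZero pp}}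
corollary1p2 p pp 2<p d _ with oddPrime pp 2<p
... | h , refl = m≤n+m 1 (2 * d) , upperBound d (proj₂ nonResidue) , minimal
  where
  open QuadraticResidues h pp using (upperBound; nonResidue; lowerBound)
  minimal : ∀ t → 1 ≤ t → AllHaveAZeroSum (A₂ p) p d t → 2 * d + 1 ≤ t
  minimal t _ allₜ with 2 * d <? t
  ... | yes 2d<t = subst (_≤ t) (+-comm 1 (2 * d)) 2d<t
  ... | no  2d≮t =
    let g , noZeroSum = lowerBound d in ⊥-elim (noZeroSum (AllHaveAZeroSum-mono {A₂ p} (≮⇒≥ 2d≮t) allₜ g))
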